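{- Let $f:\{0,1\}^n\to\{0,1\}^n$ be a Boolean network and $P$ a positive feedback vertex set of $G(f)$. The following algorithm returns exactly the set of fixed points of $f$, and it runs in time $O(n^2 2^{|P|})$ (counting evaluations of local activation functions as the basic operations). Algorithm: set $S=\emptyset$. If $P\neq\emptyset$, then for each $a\in\{0,1\}^{P}$ compute $x=\mathit{fa}^{\langle n\rangle}(\vec 0)$ and, if $\mathit{fa}(x)=x$ and $f_u(x)=a(u)$ for all $u\in P$, add $x$ to $S$. If $P=\emptyset$, compute $x=f^{\langle n\rangle}(\vec 0)$ and, if $f(x)=x$, set $S=\{x\}$. Return $S$.
   Context: A Boolean network with $n$ components is a map $f=(f_1,\dots,f_n):\{0,1\}^n\to\{0,1\}^n$; a fixed point is $x$ with $f(x)=x$. With $e_u$ the $u$-th unit vector, the interaction graph $G(f)$ is the signed digraph on $[n]$ with a positive arc $(u,v)$ if some $x$ with $x_u=0$ has $f_v(x)<f_v(x+e_u)$, and a negative arc $(u,v)$ if some $x$ with $x_u=0$ has $f_v(x)>f_v(x+e_u)$. A cycle is positive if the product of its arc signs is $+1$. A positive feedback vertex set (PFVS) is $P\subseteq[n]$ with $G(f)-P$ having no positive cycles. For $a:P\to\{0,1\}$, $\mathit{fa}$ is the Boolean network with $\mathit{fa}_v(x)=a(v)$ for $v\in P$ and $\mathit{fa}_v(x)=f_v(x)$ for $v\notin P$. $f^{\langle 0\rangle}$ is the identity, $f^{\langle k\rangle}=f\circ f^{\langle k-1\rangle}$, and $\vec 0=(0,\dots,0)$. -}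

module Defs where

open import Data.Bool using (Bool; true; false; if_then_else_; _∧_; T)
open import Data.Bool.Properties using () renaming (_≟_ to _≟B_)
open import Data.Nat using (ℕ; zero; suc; _+_; _*_; _^_; _≤_)
open import Data.Fin using (Fin)
open import Data.Fin.Subset using (Subset; _∈_; _∉_; ∣_∣; inside; outside)
open import Data.Vec using (Vec; []; _∷_; lookup; tabulate; replicate; _[_]≔_)
import Data.Vec as V
open import Data.Vec.Properties using (≡-dec)
open import Data.List using (List; []; _∷_; _++_; map)
open import Data.List.Relation.Unary.Unique.Propositional using (Unique)
open import Data.List.Relation.Unary.All using (All)
open import Data.Product using (_×_; _,_; proj₁; proj₂; Σ; ∃)
open import Relation.Binary.PropositionalEquality using (_≡_)
open import Relation.Nullary.Decidable using (does)
open import Relation.Nullary using (¬_)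

State : ℕ → Set
State n = Vec Bool n

BN : ℕ → Set
BN n = Fin n → State n → Bool

apply : ∀ {n} → BN n → State n → State n
apply f x = tabulate (λ v → f v x)

FixedPoint : ∀ {n} → BN n → State n → Set
FixedPoint f x = apply f x ≡ x

data Sign : Set where
  pos neg : Sign

_·_ : Sign → Sign → Sign
pos · s = s
neg · pos = neg
neg · neg = pos

-- Arc f s u v : there is an arc (u,v) of sign s in G(f).
-- x + e_u for x_u = 0 is x with the u-th entry set to 1.
Arc : ∀ {n} → BN n → Sign → Fin n → Fin n → Set
Arc f pos u v = ∃ λ x → lookup x u ≡ false × f v x ≡ false × f v (x [ u ]≔ true) ≡ true
Arc f neg u v = ∃ λ x → lookup x u ≡ false × f v x ≡ true × f v (x [ u ]≔ true) ≡ false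

-- SPath f u w s vs : a walk in G(f) from u to w whose arc-sign product is s,
-- with vs the list of vertices left by the walk (all visited vertices except
-- the final one w).
data SPath {n} (f : BN n) : Fin n → Fin n → Sign → List (Fin n) → Set where
  here : ∀ {u} → SPath f u u pos []
  step : ∀ {u v w s t vs} → Arc f s u v → SPath f v w t vs → SPath f u w (s · t) (u ∷ vs)

data NonEmptyList {A : Set} : List A → Set where
  nonempty : ∀ {x xs} → NonEmptyList (x ∷ xs)

PositiveCycleAvoiding : ∀ {n} → BN n → Subset n → Set
PositiveCycleAvoiding {n} f P =
  Σ (Fin n) λ u → Σ (List (Fin n)) λ vs →
    SPath f u u pos vs × NonEmptyList vs × Unique vs × All (λ v → v ∉ P) vs

IsPFVS : ∀ {n} → BN n → Subset n → Set
IsPFVS f P = ¬ PositiveCycleAvoiding f P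

-- The algorithm, instrumented with a counter of evaluations of local
-- activation functions f_v (each evaluation costs 1; everything else is free).

Counted : Set → Set
Counted A = A × ℕ

evalLocal : ∀ {n} → BN n → Fin n → State n → Counted Bool
evalLocal f v x = f v x , 1

tabulateC : ∀ {n} → (Fin n → Counted Bool) → Counted (State n)
tabulateC g = tabulate (λ v → proj₁ (g v)) , V.sum (tabulate (λ v → proj₂ (g v)))

iterateC : ∀ {n} → ℕ → (State n → Counted (State n)) → State n → Counted (State n)
iterateC zero    g x = x , 0
iterateC (suc k) g x with iterateC k g x
... | y , c with g y
...   | z , d = z , c + d

-- Assignments a ∈ {0,1}^P, represented as vectors in {0,1}^n whose entries
-- outside P are 0 (so that {0,1}^P is enumerated without repetition).
assignments : ∀ {n} → Subset n → List (Vec Bool n)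
assignments []            = [] ∷ []
assignments (outside ∷ P) = map (false ∷_) (assignments P)
assignments (inside ∷ P)  = map (false ∷_) (assignments P) ++ map (true ∷_) (assignments P)

faLocal : ∀ {n} → BN n → Subset n → Vec Bool n → Fin n → State n → Counted Bool
faLocal f P a v x = if lookup P v then (lookup a v , 0) else evalLocal f v x

applyFaC : ∀ {n} → BN n → Subset n → Vec Bool n → State n → Counted (State n)
applyFaC f P a x = tabulateC (λ v → faLocal f P a v x)

applyFC : ∀ {n} → BN n → State n → Counted (State n)
applyFC f x = tabulateC (λ v → evalLocal f v x)

checkP : ∀ {n} → BN n → Subset n → Vec Bool n → State n → Counted Bool
checkP f P a x =
  V.foldr (λ _ → Bool) _∧_ true (tabulate (λ u → proj₁ (g u))) ,
  V.sum (tabulate (λ u → proj₂ (g u)))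
  where
    g : _ → Counted Bool
    g u = if lookup P u
            then (does (proj₁ (evalLocal f u x) ≟B lookup a u) , proj₂ (evalLocal f u x))
            else (true , 0)

_≟S_ : ∀ {n} (x y : State n) → _
_≟S_ = ≡-dec _≟B_

isEmptySet : ∀ {n} → Subset n → Bool
isEmptySet []            = true
isEmptySet (outside ∷ P) = isEmptySet P
isEmptySet (inside ∷ P)  = false

zeros : ∀ {n} → State n
zeros = replicate _ false

round : ∀ {n} → BN n → Subset n → Vec Bool n → Counted (List (State n))
round {n} f P a with iterateC n (applyFaC f P a) zeros
... | x , c₁ with applyFaC f P a x | checkP f P a x
...   | y , c₂ | ok , c₃ =
  (if does (y ≟S x) ∧ ok then x ∷ [] else []) , c₁ + c₂ + c₃

loop : ∀ {n} → BN n → Subset n → List (Vec Bool n) → Counted (List (State n))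
loop f P []       = [] , 0
loop f P (a ∷ as) with round f P a | loop f P as
... | S₁ , c₁ | S₂ , c₂ = S₁ ++ S₂ , c₁ + c₂

algorithm : ∀ {n} → BN n → Subset n → Counted (List (State n))
algorithm {n} f P with isEmptySet P
... | false = loop f P (assignments P)
... | true with iterateC n (applyFC f) zeros
...   | x , c₁ with applyFC f x
...     | y , c₂ = (if does (y ≟S x) then x ∷ [] else []) , c₁ + c₂

-- Fix a ∈ {0,1}^P and let y be a fixed point of fa. If the n-th iterate x of fa
-- from any state still differs from y at a component w, then w ∉ P and
-- f_w(x) ≠ f_w(y), so some input u of w on which x and y differ carries an arc
-- u → w of G(f) whose sign is + exactly when y_u = y_w. Repeating this n times
-- yields a walk of n such arcs, each entering a vertex outside P. Its n + 1
-- vertices cannot be distinct, so it contains a cycle of G(f) − P, and that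
-- cycle is positive because the relative signs of consecutive values of y
-- telescope. Hence fa^⟨n⟩(0) is the unique fixed point of fa; every fixed point
-- x of f is found in the round a = x|_P, and the checks f_u(x) = a(u) reject
-- everything that is not a fixed point of f. Each round evaluates at most
-- n² + 2n local functions.
module Submission where

open import Defs
open import Data.Bool using (Bool; true; false; not; _∧_; if_then_else_; T)
open import Data.Bool.Properties using (¬-not; T-∧) renaming (_≟_ to _≟B_)
open import Data.Empty using (⊥)
open import Data.Fin using (Fin; zero; suc)
open import Data.Fin.Properties using (injective⇒≤) renaming (_≟_ to _≟F_)
open import Data.Fin.Subset using (Subset; ∣_∣; _∉_)
open import Data.List using (List; []; _∷_; _++_; length; map)
import Data.List as List
open import Data.List.Membership.Propositional using (_∈_) renaming (_∉_ to _∉ₗ_)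
open import Data.List.Membership.Propositional.Properties
  using (∈-lookup; ∈-map⁺; ∈-++⁺ˡ; ∈-++⁺ʳ; ∈-++⁻)
import Data.List.Membership.DecPropositional as DecMembership
open import Data.List.Properties using (length-++; length-map)
open import Data.List.Relation.Unary.All using (All; []; _∷_)
import Data.List.Relation.Unary.All as All
open import Data.List.Relation.Unary.All.Properties using (¬Any⇒All¬)
open import Data.List.Relation.Unary.AllPairs using ([]; _∷_)
open import Data.List.Relation.Unary.Any using (here; there)
open import Data.List.Relation.Unary.Unique.Propositional using (Unique)
open import Data.Nat using (ℕ; zero; suc; _+_; _*_; _^_; _≤_; z≤n)
open import Data.Nat.GeneralisedArithmetic using (fold)
open import Data.Nat.Properties
  using (≤-refl; ≤-trans; ≤-reflexive; +-mono-≤; +-monoʳ-≤; *-monoʳ-≤; m≤m+n; m≤m*n;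
         m^n≢0; 1+n≰n; +-suc; +-identityʳ; +-assoc; +-comm; *-comm; *-assoc; module ≤-Reasoning)
open import Data.Product using (Σ; ∃; ∃₂; _×_; _,_; proj₁; proj₂)
open import Data.Sum using (_⊎_; inj₁; inj₂; [_,_]′)
open import Data.Unit using (tt)
open import Data.Vec using (Vec; []; _∷_; lookup; tabulate; zipWith; _[_]≔_; foldr; sum)
open import Data.Vec.Properties
  using ([]=⇒lookup; lookup∘tabulate; lookup-zipWith; lookup∘update; []≔-idempotent; []≔-lookup)
open import Data.Vec.Relation.Binary.Pointwise.Extensional using (ext; Pointwise-≡⇒≡)
open import Function.Base using (_∘_)
open import Function.Bundles using (_⇔_; mk⇔; Equivalence)
open import Relation.Binary.PropositionalEquality
  using (_≡_; _≢_; refl; sym; trans; cong; cong₂; subst; ≢-sym; module ≡-Reasoning)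
open import Relation.Nullary using (¬_; Dec; yes; no; does; contradiction)
open import Relation.Nullary.Decidable using (decidable-stable)

T-does⁻ : ∀ {B : Set} (d : Dec B) → T (does d) → B
T-does⁻ (yes b) _ = b

T-does⁺ : ∀ {B : Set} (d : Dec B) → B → T (does d)
T-does⁺ (yes _) _ = tt
T-does⁺ (no ¬b) b = ¬b b

∈-if-singleton⁻ : ∀ {A : Set} {b} {x z : A} → z ∈ (if b then x ∷ [] else []) → T b × z ≡ x
∈-if-singleton⁻ {b = true} (here z≡x) = tt , z≡x

∈-if-singleton⁺ : ∀ {A : Set} {b} {x : A} → T b → x ∈ (if b then x ∷ [] else [])
∈-if-singleton⁺ {b = true} _ = here refl

lookup-injective : ∀ {A : Set} {xs : List A} → Unique xs →
                   ∀ {i j} → List.lookup xs i ≡ List.lookup xs j → i ≡ j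
lookup-injective (_ ∷ _)      {zero}  {zero}  _  = refl
lookup-injective (x∉xs ∷ _)   {zero}  {suc j} eq = contradiction eq (All.lookup x∉xs (∈-lookup j))
lookup-injective (x∉xs ∷ _)   {suc i} {zero}  eq =
  contradiction (sym eq) (All.lookup x∉xs (∈-lookup i))
lookup-injective (_ ∷ unique) {suc i} {suc j} eq = cong suc (lookup-injective unique eq)

length-unique : ∀ {n} {xs : List (Fin n)} → Unique xs → length xs ≤ n
length-unique unique = injective⇒≤ (lookup-injective unique)

sum-tabulate-≤ : ∀ {m} (h : Fin m → ℕ) → (∀ i → h i ≤ 1) → sum (tabulate h) ≤ m
sum-tabulate-≤ {zero}  h bound = z≤n
sum-tabulate-≤ {suc m} h bound = +-mono-≤ (bound zero) (sum-tabulate-≤ (h ∘ suc) (bound ∘ suc))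

T-foldr-∧⁻ : ∀ {m} (g : Fin m → Bool) → T (foldr _ _∧_ true (tabulate g)) → ∀ i → T (g i)
T-foldr-∧⁻ g t zero    = proj₁ (Equivalence.to T-∧ t)
T-foldr-∧⁻ g t (suc i) = T-foldr-∧⁻ (g ∘ suc) (proj₂ (Equivalence.to T-∧ t)) i

T-foldr-∧⁺ : ∀ {m} (g : Fin m → Bool) → (∀ i → T (g i)) → T (foldr _ _∧_ true (tabulate g))
T-foldr-∧⁺ {zero}  g t = tt
T-foldr-∧⁺ {suc m} g t = Equivalence.from T-∧ (t zero , T-foldr-∧⁺ (g ∘ suc) (t ∘ suc))

n≤n*n : ∀ n → n ≤ n * n
n≤n*n zero    = z≤n
n≤n*n (suc n) = m≤m*n (suc n) (suc n)

quadratic-bound : ∀ n → n * n + n + n ≤ 3 * (n * n)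
quadratic-bound n = begin
  n * n + n + n           ≤⟨ +-mono-≤ (+-monoʳ-≤ (n * n) (n≤n*n n)) (n≤n*n n) ⟩
  n * n + n * n + n * n   ≡⟨ +-assoc (n * n) (n * n) (n * n) ⟩
  n * n + (n * n + n * n) ≡⟨ cong (λ m → n * n + (n * n + m)) (+-identityʳ (n * n)) ⟨
  3 * (n * n)             ∎
  where open ≤-Reasoning

relativeSign : Bool → Bool → Sign
relativeSign false false = pos
relativeSign true  true  = pos
relativeSign false true  = neg
relativeSign true  false = neg

relativeSign-refl : ∀ a → relativeSign a a ≡ pos
relativeSign-refl false = refl
relativeSign-refl true  = refl

relativeSign-trans : ∀ a b c → relativeSign a b · relativeSign b c ≡ relativeSign a c
relativeSign-trans false false false = refl
relativeSign-trans false false true  = refl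
relativeSign-trans false true  false = refl
relativeSign-trans false true  true  = refl
relativeSign-trans true  false false = refl
relativeSign-trans true  false true  = refl
relativeSign-trans true  true  false = refl
relativeSign-trans true  true  true  = refl

relativeSign-not : ∀ a b → relativeSign (not a) (not b) ≡ relativeSign a b
relativeSign-not false false = refl
relativeSign-not false true  = refl
relativeSign-not true  false = refl
relativeSign-not true  true  = refl

relativeSign-≢ : ∀ {a b c d} → a ≢ c → b ≢ d → relativeSign a b ≡ relativeSign c d
relativeSign-≢ {c = c} {d = d} a≢c b≢d =
  trans (cong₂ relativeSign (¬-not a≢c) (¬-not b≢d)) (relativeSign-not c d)

-- Sensitive coordinates and arcs of G(f)

FixedPoint⇔pointwise : ∀ {n} (h : BN n) (x : State n) →
                       FixedPoint h x ⇔ (∀ w → h w x ≡ lookup x w)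
FixedPoint⇔pointwise h x = mk⇔
  (λ fixed w → trans (sym (lookup∘tabulate (λ v → h v x) w)) (cong (λ z → lookup z w) fixed))
  (λ fixed → Pointwise-≡⇒≡ (ext λ w → trans (lookup∘tabulate (λ v → h v x) w) (fixed w)))

sensitive-coordinate :
  ∀ {m} (g : Vec Bool m → Bool) (z y : Vec Bool m) → g z ≢ g y →
  ∃₂ λ u z′ → lookup z′ u ≡ lookup z u × lookup z u ≢ lookup y u ×
              g z′ ≡ g z × g z′ ≢ g (z′ [ u ]≔ lookup y u)
sensitive-coordinate g [] [] g[]≢g[] = contradiction refl g[]≢g[]
sensitive-coordinate g (a ∷ z) (b ∷ y) gz≢gy with g (b ∷ z) ≟B g (a ∷ z)
... | no changes =
  zero , a ∷ z , refl , (λ a≡b → changes (cong (λ c → g (c ∷ z)) (sym a≡b))) ,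
  refl , ≢-sym changes
... | yes same
  with sensitive-coordinate (λ t → g (b ∷ t)) z y (λ eq → gz≢gy (trans (sym same) eq))
...   | u , z′ , z′u≡zu , zu≢yu , gz′≡gz , sensitive =
  suc u , b ∷ z′ , z′u≡zu , zu≢yu , trans gz′≡gz same , sensitive

module _ {n} (f : BN n) {u v : Fin n} where

  arc-of-increase : ∀ {x} → lookup x u ≡ false → f v x ≢ f v (x [ u ]≔ true) →
                    Arc f (relativeSign false (f v x)) u v
  arc-of-increase {x} xu≡0 changes with f v x in before | f v (x [ u ]≔ true) in after
  ... | false | true  = x , xu≡0 , before , after
  ... | true  | false = x , xu≡0 , before , after
  ... | false | false = contradiction refl changes
  ... | true  | true  = contradiction refl changes

  arc-of-decrease : ∀ {x} → lookup x u ≡ true → f v x ≢ f v (x [ u ]≔ false) →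
                    Arc f (relativeSign true (f v x)) u v
  arc-of-decrease {x} xu≡1 changes =
    subst (λ s → Arc f s u v) sign (arc-of-increase (lookup∘update u x false) changes′)
    where
      x₀ : State n
      x₀ = x [ u ]≔ false

      raise : x₀ [ u ]≔ true ≡ x
      raise = trans ([]≔-idempotent x u) (trans (cong (x [ u ]≔_) (sym xu≡1)) ([]≔-lookup x u))

      changes′ : f v x₀ ≢ f v (x₀ [ u ]≔ true)
      changes′ eq = changes (sym (trans eq (cong (f v) raise)))

      sign : relativeSign false (f v x₀) ≡ relativeSign true (f v x)
      sign = trans (cong (relativeSign false) (¬-not (≢-sym changes))) (relativeSign-not true (f v x))

  arc-of-flip : ∀ {x c} → lookup x u ≢ c → f v x ≢ f v (x [ u ]≔ c) →
                Arc f (relativeSign (lookup x u) (f v x)) u v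
  arc-of-flip {x} {c} xu≢c changes with lookup x u in xu
  arc-of-flip {c = false} xu≢c changes | false = contradiction refl xu≢c
  arc-of-flip {c = true}  xu≢c changes | false = arc-of-increase xu changes
  arc-of-flip {c = false} xu≢c changes | true  = arc-of-decrease xu changes
  arc-of-flip {c = true}  xu≢c changes | true  = contradiction refl xu≢c

arc-towards : ∀ {n} (f : BN n) {w} (z y : State n) → f w z ≢ f w y →
              ∃ λ u → lookup z u ≢ lookup y u × Arc f (relativeSign (lookup z u) (f w z)) u w
arc-towards f {w} z y fz≢fy with sensitive-coordinate (f w) z y fz≢fy
... | u , z′ , z′u≡zu , zu≢yu , fz′≡fz , sensitive =
  u , zu≢yu ,
  subst (λ s → Arc f s u w) (cong₂ relativeSign z′u≡zu fz′≡fz)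
        (arc-of-flip f (λ eq → zu≢yu (trans (sym z′u≡zu) eq)) sensitive)

-- Walks of consistent arcs and convergence of fa

Outside : ∀ {n} → Subset n → Fin n → Set
Outside P w = lookup P w ≡ false

Outside⇒∉ : ∀ {n} {P : Subset n} {w} → Outside P w → w ∉ P
Outside⇒∉ out w∈P with trans (sym ([]=⇒lookup w∈P)) out
... | ()

inside-or-outside : ∀ {n} (P : Subset n) w → lookup P w ≡ true ⊎ Outside P w
inside-or-outside P w with lookup P w
... | true  = inj₁ refl
... | false = inj₂ refl

-- Every closed walk of consistent arcs is positive: relative signs telescope.
module Consistent {n} (f : BN n) (P : Subset n) (y : State n) where

  open DecMembership (_≟F_ {n}) using (_∈?_)

  ConsistentArc : Fin n → Fin n → Set
  ConsistentArc u w = Outside P w × Arc f (relativeSign (lookup y u) (lookup y w)) u w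

  data Walk : ℕ → Fin n → Set where
    start : ∀ w → Walk 0 w
    _▷_   : ∀ {k u w} → Walk k u → ConsistentArc u w → Walk (suc k) w

  _◅_ : ∀ {u w t vs} → ConsistentArc u w →
        SPath f w t (relativeSign (lookup y w) (lookup y t)) vs →
        SPath f u t (relativeSign (lookup y u) (lookup y t)) (u ∷ vs)
  _◅_ {u} {w} {t} {vs} (_ , arc) path =
    subst (λ s → SPath f u t s (u ∷ vs)) (relativeSign-trans (lookup y u) (lookup y w) (lookup y t))
          (step arc path)

  SimplePathWithin : List (Fin n) → Fin n → Fin n → Set
  SimplePathWithin L w t = ∃ λ vs →
    SPath f w t (relativeSign (lookup y w) (lookup y t)) vs × Unique vs × t ∉ₗ vs × All (_∈ L) vs

  Reaches : Fin n → List (Fin n) → Set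
  Reaches w T = ∀ {t} → t ∈ w ∷ T → SimplePathWithin (w ∷ T) w t

  reaches-self : ∀ {L w} → SimplePathWithin L w w
  reaches-self {w = w} =
    [] , subst (λ s → SPath f w w s []) (sym (relativeSign-refl (lookup y w))) here , [] , (λ ()) , []

  reaches-[] : ∀ {w} → Reaches w []
  reaches-[] (here refl) = reaches-self

  reaches-∷ : ∀ {u w T} → ConsistentArc u w → u ∉ₗ w ∷ T → Reaches w T → Reaches u (w ∷ T)
  reaches-∷ arc u∉wT reach (here refl) = reaches-self
  reaches-∷ arc u∉wT reach (there t∈wT) with reach t∈wT
  ... | vs , path , unique , t∉vs , vs⊆wT =
    _ ∷ vs , arc ◅ path ,
    ¬Any⇒All¬ vs (λ u∈vs → u∉wT (All.lookup vs⊆wT u∈vs)) ∷ unique ,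
    (λ { (here refl) → u∉wT t∈wT ; (there t∈vs) → t∉vs t∈vs }) ,
    here refl ∷ All.map there vs⊆wT

  positive-cycle : ∀ {u w T} → ConsistentArc u w → u ∈ w ∷ T → All (Outside P) (w ∷ T) →
                   Reaches w T → PositiveCycleAvoiding f P
  positive-cycle {u} arc u∈wT outsideT reach with reach u∈wT
  ... | vs , path , unique , u∉vs , vs⊆wT =
    u , u ∷ vs ,
    subst (λ s → SPath f u u s (u ∷ vs)) (relativeSign-refl (lookup y u)) (arc ◅ path) ,
    nonempty , ¬Any⇒All¬ vs u∉vs ∷ unique ,
    All.map Outside⇒∉ (All.lookup outsideT u∈wT ∷ All.map (All.lookup outsideT) vs⊆wT)

  module _ (pfvs : IsPFVS f P) where

    -- The walk is traced backwards from its end, T holding the vertices already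
    -- visited; the first repeated vertex closes a simple positive cycle.
    no-walk-from-trail : ∀ {k w T} → Walk k w → Unique (w ∷ T) → All (Outside P) T →
                         Reaches w T → k + length T ≡ n → ⊥
    no-walk-from-trail (start w) unique _ _ T≡n =
      1+n≰n (subst (λ m → suc m ≤ n) T≡n (length-unique unique))
    no-walk-from-trail {suc k} {w} {T} (_▷_ {u = u} walk arc) unique outsideT reach k+T≡n
      with u ∈? w ∷ T
    ... | yes u∈wT = pfvs (positive-cycle arc u∈wT (proj₁ arc ∷ outsideT) reach)
    ... | no u∉wT  =
      no-walk-from-trail walk (¬Any⇒All¬ (w ∷ T) u∉wT ∷ unique) (proj₁ arc ∷ outsideT)
        (reaches-∷ arc u∉wT reach) (trans (+-suc k (length T)) k+T≡n)

    no-walk : ∀ {w} → ¬ Walk n w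
    no-walk walk = no-walk-from-trail walk ([] ∷ []) [] reaches-[] (+-identityʳ n)

-- Used with h = fa, and with h = f when P = ∅.
module Convergence {n} (f : BN n) (P : Subset n) (pfvs : IsPFVS f P) (h : BN n)
  (h-outside : ∀ {w} → Outside P w → ∀ x → h w x ≡ f w x)
  (h-inside : ∀ {w} → lookup P w ≡ true → ∀ x x′ → h w x ≡ h w x′)
  {y : State n} (fixed : FixedPoint h y) (x₀ : State n) where

  open Consistent f P y

  X : ℕ → State n
  X k = fold x₀ (apply h) k

  hy≡y : ∀ w → h w y ≡ lookup y w
  hy≡y = Equivalence.to (FixedPoint⇔pointwise h y) fixed

  lookup-X-suc : ∀ k w → lookup (X (suc k)) w ≡ h w (X k)
  lookup-X-suc k = lookup∘tabulate (λ v → h v (X k))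

  fy≡y : ∀ {w} → Outside P w → f w y ≡ lookup y w
  fy≡y {w} Pw = trans (sym (h-outside Pw y)) (hy≡y w)

  f-deviates : ∀ k {w} → Outside P w → lookup (X (suc k)) w ≢ lookup y w → f w (X k) ≢ lookup y w
  f-deviates k {w} Pw deviates eq = deviates (trans (lookup-X-suc k w) (trans (h-outside Pw (X k)) eq))

  deviation-arc : ∀ k {w} → lookup (X (suc k)) w ≢ lookup y w →
                  ∃ λ u → lookup (X k) u ≢ lookup y u × ConsistentArc u w
  deviation-arc k {w} deviates with inside-or-outside P w
  ... | inj₁ Pw =
    contradiction (trans (lookup-X-suc k w) (trans (h-inside Pw (X k) y) (hy≡y w))) deviates
  ... | inj₂ Pw with arc-towards f (X k) y (λ eq → f-deviates k Pw deviates (trans eq (fy≡y Pw)))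
  ...   | u , Xu≢yu , arc =
    u , Xu≢yu , Pw , subst (λ s → Arc f s u w) (relativeSign-≢ Xu≢yu (f-deviates k Pw deviates)) arc

  deviation-walk : ∀ k {w} → lookup (X k) w ≢ lookup y w → Walk k w
  deviation-walk zero    _ = start _
  deviation-walk (suc k) deviates with deviation-arc k deviates
  ... | _ , Xu≢yu , arc = deviation-walk k Xu≢yu ▷ arc

  converges : X n ≡ y
  converges = Pointwise-≡⇒≡ (ext λ w →
    decidable-stable (lookup (X n) w ≟B lookup y w) (no-walk pfvs ∘ deviation-walk n))

-- The algorithm

iterateC-value : ∀ {n} k (g : State n → Counted (State n)) x →
             proj₁ (iterateC k g x) ≡ fold x (proj₁ ∘ g) k
iterateC-value zero    g x = refl
iterateC-value (suc k) g x with iterateC k g x | iterateC-value k g x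
... | y , _ | refl = refl

iterateC-cost : ∀ {n} k (g : State n → Counted (State n)) {b} → (∀ x → proj₂ (g x) ≤ b) →
                ∀ x → proj₂ (iterateC k g x) ≤ k * b
iterateC-cost zero    g bound x = z≤n
iterateC-cost (suc k) g {b} bound x with iterateC k g x | iterateC-cost k g bound x
... | y , c | c≤kb = ≤-trans (+-mono-≤ c≤kb (bound y)) (≤-reflexive (+-comm (k * b) b))

restrict : ∀ {n} → Subset n → State n → Vec Bool n
restrict P x = zipWith _∧_ P x

restrict-inside : ∀ {n} (P : Subset n) x {w} → lookup P w ≡ true → lookup (restrict P x) w ≡ lookup x w
restrict-inside P x {w} Pw = trans (lookup-zipWith _∧_ w P x) (cong (_∧ lookup x w) Pw)

restrict-∈-assignments : ∀ {n} (P : Subset n) x → restrict P x ∈ assignments P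
restrict-∈-assignments []          []          = here refl
restrict-∈-assignments (false ∷ P) (_ ∷ x)     = ∈-map⁺ (false ∷_) (restrict-∈-assignments P x)
restrict-∈-assignments (true ∷ P)  (false ∷ x) =
  ∈-++⁺ˡ (∈-map⁺ (false ∷_) (restrict-∈-assignments P x))
restrict-∈-assignments (true ∷ P)  (true ∷ x)  =
  ∈-++⁺ʳ (map (false ∷_) (assignments P)) (∈-map⁺ (true ∷_) (restrict-∈-assignments P x))

length-assignments : ∀ {n} (P : Subset n) → length (assignments P) ≡ 2 ^ ∣ P ∣
length-assignments []          = refl
length-assignments (false ∷ P) = trans (length-map (false ∷_) (assignments P)) (length-assignments P)
length-assignments (true ∷ P)  = begin
  length (map (false ∷_) (assignments P) ++ map (true ∷_) (assignments P))
    ≡⟨ length-++ (map (false ∷_) (assignments P)) ⟩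
  length (map (false ∷_) (assignments P)) + length (map (true ∷_) (assignments P))
    ≡⟨ cong₂ _+_ (length-map (false ∷_) (assignments P)) (length-map (true ∷_) (assignments P)) ⟩
  length (assignments P) + length (assignments P)
    ≡⟨ cong (λ m → m + m) (length-assignments P) ⟩
  2 ^ ∣ P ∣ + 2 ^ ∣ P ∣
    ≡⟨ cong (2 ^ ∣ P ∣ +_) (+-identityʳ (2 ^ ∣ P ∣)) ⟨
  2 * 2 ^ ∣ P ∣ ∎
  where open ≡-Reasoning

isEmptySet⇒outside : ∀ {n} (P : Subset n) → isEmptySet P ≡ true → ∀ w → Outside P w
isEmptySet⇒outside (false ∷ P) empty zero    = refl
isEmptySet⇒outside (false ∷ P) empty (suc w) = isEmptySet⇒outside P empty w

FindsFixedPoints : ∀ {n} → BN n → List (State n) → Set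
FindsFixedPoints f S = ∀ x → x ∈ S ⇔ FixedPoint f x

CorrectWithin : ∀ {n} → BN n → ℕ → Counted (List (State n)) → Set
CorrectWithin f b result = FindsFixedPoints f (proj₁ result) × proj₂ result ≤ b

module Rounds {n} (f : BN n) (P : Subset n) where

  fa : Vec Bool n → BN n
  fa a v x = proj₁ (faLocal f P a v x)

  fa-outside : ∀ a {w} → Outside P w → ∀ x → fa a w x ≡ f w x
  fa-outside a Pw x rewrite Pw = refl

  fa-inside : ∀ a {w} → lookup P w ≡ true → ∀ x → fa a w x ≡ lookup a w
  fa-inside a Pw x rewrite Pw = refl

  candidate : Vec Bool n → State n
  candidate a = proj₁ (iterateC n (applyFaC f P a) zeros)

  accepted : Vec Bool n → State n → Bool
  accepted a x = does (proj₁ (applyFaC f P a x) ≟S x) ∧ proj₁ (checkP f P a x)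

  round-≡ : ∀ a → round f P a ≡
    ((if accepted a (candidate a) then candidate a ∷ [] else []) ,
     proj₂ (iterateC n (applyFaC f P a) zeros) + proj₂ (applyFaC f P a (candidate a))
       + proj₂ (checkP f P a (candidate a)))
  round-≡ a with iterateC n (applyFaC f P a) zeros
  ... | x , _ with applyFaC f P a x | checkP f P a x
  ...   | _ , _ | _ , _ = refl

  loop-∷ : ∀ a as → loop f P (a ∷ as) ≡
    (proj₁ (round f P a) ++ proj₁ (loop f P as) , proj₂ (round f P a) + proj₂ (loop f P as))
  loop-∷ a as with round f P a | loop f P as
  ... | _ , _ | _ , _ = refl

  Agrees : Vec Bool n → State n → Set
  Agrees a x = ∀ u → lookup P u ≡ true → f u x ≡ lookup a u

  checkP-sound : ∀ a x → T (proj₁ (checkP f P a x)) → Agrees a x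
  checkP-sound a x ok u Pu with lookup P u | T-foldr-∧⁻ _ ok u
  ... | true | agrees = T-does⁻ (f u x ≟B lookup a u) agrees

  checkP-complete : ∀ a x → Agrees a x → T (proj₁ (checkP f P a x))
  checkP-complete a x agrees = T-foldr-∧⁺ _ agrees-at
    where
      agrees-at : ∀ u →
        T (proj₁ (if lookup P u then (does (f u x ≟B lookup a u) , 1) else (true , 0)))
      agrees-at u with lookup P u in Pu
      ... | false = tt
      ... | true  = T-does⁺ (f u x ≟B lookup a u) (agrees u Pu)

  fixedPoint-of-fa : ∀ a x → FixedPoint (fa a) x → Agrees a x → FixedPoint f x
  fixedPoint-of-fa a x fixed agrees = Equivalence.from (FixedPoint⇔pointwise f x) λ w →
    [ (λ Pw → trans (agrees w Pw) (trans (sym (fa-inside a Pw x)) (fa-fixed w)))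
    , (λ Pw → trans (sym (fa-outside a Pw x)) (fa-fixed w))
    ]′ (inside-or-outside P w)
    where
      fa-fixed : ∀ w → fa a w x ≡ lookup x w
      fa-fixed = Equivalence.to (FixedPoint⇔pointwise (fa a) x) fixed

  restrict-agrees : ∀ {x} → FixedPoint f x → Agrees (restrict P x) x
  restrict-agrees {x} fixed u Pu =
    trans (Equivalence.to (FixedPoint⇔pointwise f x) fixed u) (sym (restrict-inside P x Pu))

  fixedPoint-restrict : ∀ {x} → FixedPoint f x → FixedPoint (fa (restrict P x)) x
  fixedPoint-restrict {x} fixed = Equivalence.from (FixedPoint⇔pointwise (fa (restrict P x)) x) λ w →
    [ (λ Pw → trans (fa-inside (restrict P x) Pw x) (restrict-inside P x Pw))
    , (λ Pw → trans (fa-outside (restrict P x) Pw x)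
                    (Equivalence.to (FixedPoint⇔pointwise f x) fixed w))
    ]′ (inside-or-outside P w)

  accepted-sound : ∀ a x → T (accepted a x) → FixedPoint f x
  accepted-sound a x ok with Equivalence.to T-∧ ok
  ... | fixed , checked =
    fixedPoint-of-fa a x (T-does⁻ (proj₁ (applyFaC f P a x) ≟S x) fixed) (checkP-sound a x checked)

  accepted-complete : ∀ {x} → FixedPoint f x → T (accepted (restrict P x) x)
  accepted-complete {x} fixed = Equivalence.from T-∧
    ( T-does⁺ (proj₁ (applyFaC f P (restrict P x) x) ≟S x) (fixedPoint-restrict {x} fixed)
    , checkP-complete (restrict P x) x (restrict-agrees fixed))

  candidate-converges : IsPFVS f P → ∀ {a y} → FixedPoint (fa a) y → candidate a ≡ y
  candidate-converges pfvs {a} fixed =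
    trans (iterateC-value n (applyFaC f P a) zeros)
          (Convergence.converges f P pfvs (fa a) (fa-outside a) fa-constant fixed zeros)
    where
      fa-constant : ∀ {w} → lookup P w ≡ true → ∀ x x′ → fa a w x ≡ fa a w x′
      fa-constant Pw x x′ = trans (fa-inside a Pw x) (sym (fa-inside a Pw x′))

  round-sound : ∀ a {x} → x ∈ proj₁ (round f P a) → FixedPoint f x
  round-sound a {x} x∈ with ∈-if-singleton⁻ (subst (x ∈_) (cong proj₁ (round-≡ a)) x∈)
  ... | ok , refl = accepted-sound a x ok

  round-complete : IsPFVS f P → ∀ {x} → FixedPoint f x → x ∈ proj₁ (round f P (restrict P x))
  round-complete pfvs {x} fixed = subst (x ∈_) (sym (cong proj₁ (round-≡ a))) x∈candidates
    where
      a : Vec Bool n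
      a = restrict P x

      converged : candidate a ≡ x
      converged = candidate-converges pfvs {a} (fixedPoint-restrict {x} fixed)

      x∈candidates : x ∈ (if accepted a (candidate a) then candidate a ∷ [] else [])
      x∈candidates rewrite converged = ∈-if-singleton⁺ (accepted-complete fixed)

  applyFaC-cost : ∀ a x → proj₂ (applyFaC f P a x) ≤ n
  applyFaC-cost a x = sum-tabulate-≤ _ cost
    where
      cost : ∀ v → proj₂ (faLocal f P a v x) ≤ 1
      cost v with lookup P v
      ... | true  = z≤n
      ... | false = ≤-refl

  checkP-cost : ∀ a x → proj₂ (checkP f P a x) ≤ n
  checkP-cost a x = sum-tabulate-≤ _ cost
    where
      cost : ∀ u → proj₂ (if lookup P u then (does (f u x ≟B lookup a u) , 1) else (true , 0)) ≤ 1
      cost u with lookup P u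
      ... | true  = ≤-refl
      ... | false = z≤n

  round-cost : ∀ a → proj₂ (round f P a) ≤ 3 * (n * n)
  round-cost a = begin
    proj₂ (round f P a)
      ≡⟨ cong proj₂ (round-≡ a) ⟩
    proj₂ (iterateC n (applyFaC f P a) zeros) + proj₂ (applyFaC f P a (candidate a))
      + proj₂ (checkP f P a (candidate a))
      ≤⟨ +-mono-≤ (+-mono-≤ (iterateC-cost n (applyFaC f P a) (applyFaC-cost a) zeros)
                            (applyFaC-cost a (candidate a)))
                  (checkP-cost a (candidate a)) ⟩
    n * n + n + n
      ≤⟨ quadratic-bound n ⟩
    3 * (n * n) ∎
    where open ≤-Reasoning

  ∈-loop⁻ : ∀ as {x} → x ∈ proj₁ (loop f P as) → ∃ λ a → x ∈ proj₁ (round f P a)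
  ∈-loop⁻ (a ∷ as) {x} x∈
    with ∈-++⁻ (proj₁ (round f P a)) (subst (x ∈_) (cong proj₁ (loop-∷ a as)) x∈)
  ... | inj₁ x∈round = a , x∈round
  ... | inj₂ x∈loop  = ∈-loop⁻ as x∈loop

  ∈-loop⁺ : ∀ {as a x} → a ∈ as → x ∈ proj₁ (round f P a) → x ∈ proj₁ (loop f P as)
  ∈-loop⁺ {a ∷ as} {x = x} (here refl) x∈ =
    subst (x ∈_) (sym (cong proj₁ (loop-∷ a as))) (∈-++⁺ˡ x∈)
  ∈-loop⁺ {b ∷ as} {x = x} (there a∈as) x∈ =
    subst (x ∈_) (sym (cong proj₁ (loop-∷ b as)))
      (∈-++⁺ʳ (proj₁ (round f P b)) (∈-loop⁺ a∈as x∈))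

  loop-cost : ∀ as {b} → (∀ a → proj₂ (round f P a) ≤ b) → proj₂ (loop f P as) ≤ length as * b
  loop-cost []       bound = z≤n
  loop-cost (a ∷ as) bound =
    ≤-trans (≤-reflexive (cong proj₂ (loop-∷ a as))) (+-mono-≤ (bound a) (loop-cost as bound))

  loop-correct : IsPFVS f P → CorrectWithin f (3 * (n * n * 2 ^ ∣ P ∣)) (loop f P (assignments P))
  loop-correct pfvs =
    (λ x → mk⇔ (λ x∈ → let (a , x∈round) = ∈-loop⁻ (assignments P) x∈
                       in round-sound a x∈round)
               (λ fixed → ∈-loop⁺ (restrict-∈-assignments P x) (round-complete pfvs fixed))) ,
    (begin
      proj₂ (loop f P (assignments P))      ≤⟨ loop-cost (assignments P) round-cost ⟩
      length (assignments P) * (3 * (n * n)) ≡⟨ cong (_* (3 * (n * n))) (length-assignments P) ⟩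
      2 ^ ∣ P ∣ * (3 * (n * n))             ≡⟨ *-comm (2 ^ ∣ P ∣) (3 * (n * n)) ⟩
      3 * (n * n) * 2 ^ ∣ P ∣               ≡⟨ *-assoc 3 (n * n) (2 ^ ∣ P ∣) ⟩
      3 * (n * n * 2 ^ ∣ P ∣)               ∎)
    where open ≤-Reasoning

algorithm-nonempty : ∀ {n} (f : BN n) P → isEmptySet P ≡ false →
                     algorithm f P ≡ loop f P (assignments P)
algorithm-nonempty f P not-empty with isEmptySet P
... | false = refl
algorithm-nonempty f P () | true

limit : ∀ {n} → BN n → State n
limit {n} f = proj₁ (iterateC n (applyFC f) zeros)

algorithm-empty : ∀ {n} (f : BN n) P → isEmptySet P ≡ true → algorithm f P ≡
  ((if does (proj₁ (applyFC f (limit f)) ≟S limit f) then limit f ∷ [] else []) ,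
   proj₂ (iterateC n (applyFC f) zeros) + proj₂ (applyFC f (limit f)))
algorithm-empty {n} f P empty with isEmptySet P
algorithm-empty {n} f P () | false
... | true with iterateC n (applyFC f) zeros
...   | x , _ with applyFC f x
...     | _ , _ = refl

module WithoutFeedbackVertices {n} (f : BN n) (P : Subset n) (pfvs : IsPFVS f P)
  (empty : isEmptySet P ≡ true) where

  limit-converges : ∀ {x} → FixedPoint f x → limit f ≡ x
  limit-converges fixed =
    trans (iterateC-value n (applyFC f) zeros)
          (Convergence.converges f P pfvs f (λ _ _ → refl) nothing-inside fixed zeros)
    where
      nothing-inside : ∀ {w} → lookup P w ≡ true → ∀ x x′ → f w x ≡ f w x′
      nothing-inside {w} Pw with () ← trans (sym Pw) (isEmptySet⇒outside P empty w)

  candidates : List (State n)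
  candidates = if does (proj₁ (applyFC f (limit f)) ≟S limit f) then limit f ∷ [] else []

  sound : ∀ {x} → x ∈ candidates → FixedPoint f x
  sound x∈ with ∈-if-singleton⁻ x∈
  ... | fixed , refl = T-does⁻ (proj₁ (applyFC f (limit f)) ≟S limit f) fixed

  complete : ∀ {x} → FixedPoint f x → x ∈ candidates
  complete fixed with limit-converges fixed
  ... | refl = ∈-if-singleton⁺ (T-does⁺ (proj₁ (applyFC f (limit f)) ≟S limit f) fixed)

  correct : CorrectWithin f (3 * (n * n * 2 ^ ∣ P ∣)) (algorithm f P)
  correct rewrite algorithm-empty f P empty = (λ x → mk⇔ sound complete) , (begin
    proj₂ (iterateC n (applyFC f) zeros) + proj₂ (applyFC f (limit f))
      ≤⟨ +-mono-≤ (iterateC-cost n (applyFC f) (λ x → sum-tabulate-≤ _ λ _ → ≤-refl) zeros)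
                  (sum-tabulate-≤ _ λ _ → ≤-refl) ⟩
    n * n + n           ≤⟨ m≤m+n (n * n + n) n ⟩
    n * n + n + n       ≤⟨ quadratic-bound n ⟩
    3 * (n * n)         ≤⟨ *-monoʳ-≤ 3 (m≤m*n (n * n) (2 ^ ∣ P ∣) {{m^n≢0 2 ∣ P ∣}}) ⟩
    3 * (n * n * 2 ^ ∣ P ∣) ∎)
    where open ≤-Reasoning

algorithm-correct : ∀ {n} (f : BN n) P → IsPFVS f P →
                    CorrectWithin f (3 * (n * n * 2 ^ ∣ P ∣)) (algorithm f P)
-- Abstracting the decision rather than isEmptySet P keeps algorithm f P folded.
algorithm-correct f P pfvs with isEmptySet P ≟B true
... | yes empty    = WithoutFeedbackVertices.correct f P pfvs empty
... | no not-empty =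
  subst (CorrectWithin f _) (sym (algorithm-nonempty f P (¬-not not-empty)))
        (Rounds.loop-correct f P pfvs)

proposition3 : Σ ℕ λ C → ∀ (n : ℕ) (f : BN n) (P : Subset n) → IsPFVS f P →
    (∀ (x : State n) → (x ∈ proj₁ (algorithm f P)) ⇔ FixedPoint f x)
    × proj₂ (algorithm f P) ≤ C * (n * n * 2 ^ ∣ P ∣)
proposition3 = 3 , λ n → algorithm-correct
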